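{- Let $G=(V,E)$ be a finite undirected graph with parameters $\vartheta_w\in[0,1]$ for $w\in V$, and consider the linear threshold model with slackness on $G$. For every $v\in V$, $\sigma(\{v\})\le\deg(v)+1$.
   Context: Linear threshold model with slackness on an undirected graph $G=(V,E)$ with parameters $(\vartheta_w)_{w\in V}$: each undirected edge $\{x,y\}$ is regarded as the two directed edges $(x,y),(y,x)$. Independently for each vertex $w$ with $\deg(w)>0$: with probability $1-\vartheta_w$, $w$ selects no live incoming edge; with probability $\vartheta_w$, $w$ selects exactly one of its $\deg(w)$ incoming directed edges uniformly at random as "live". Vertices of degree $0$ select nothing. Given a seed set $S$, the infected vertices are those reachable from $S$ by directed paths of live edges (including $S$ itself), and $\sigma(S)$ is the expected number of infected vertices.
   Formalization: The parameters $\vartheta_w$ are rational numbers in [0,1]. -}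

module Defs where

open import Data.Nat using (ℕ; zero; suc)
open import Data.Integer using (+_)
open import Data.Fin using (Fin; zero; suc)
open import Data.Bool using (Bool; true; false; if_then_else_; _∨_)
open import Data.Maybe using (Maybe; nothing; just)
open import Data.List using (List; []; _∷_; map; concatMap; foldr)
open import Data.Nat.ListAction using (sum)
open import Relation.Nullary.Decidable using (⌊_⌋)
open import Data.Fin using (_≟_)
open import Data.List using () renaming (allFin to allFinL)
open import Data.Rational using (ℚ; 0ℚ; 1ℚ; _+_; _*_; _-_; _/_)
open import Relation.Binary.PropositionalEquality using (_≡_)

record Graph (n : ℕ) : Set where
  field
    adj   : Fin n → Fin n → Bool
    symm  : ∀ x y → adj x y ≡ adj y x
    irref : ∀ x → adj x x ≡ false
open Graph public

countB : ∀ {n} → (Fin n → Bool) → ℕ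
countB {n} p = sum (map (λ u → if p u then 1 else 0) (allFinL n))

deg : ∀ {n} → Graph n → Fin n → ℕ
deg G w = countB (adj G w)

-- A live-edge configuration: each vertex w selects either no live incoming
-- edge (nothing) or the tail u of its live incoming edge (u , w) (just u).
Config : ℕ → Set
Config n = Fin n → Maybe (Fin n)

consF : ∀ {k} {A : Set} → A → (Fin k → A) → Fin (suc k) → A
consF a f zero    = a
consF a f (suc i) = f i

choices : ∀ m → List (Maybe (Fin m))
choices m = nothing ∷ map just (allFinL m)

allConfigs : ∀ k m → List (Fin k → Maybe (Fin m))
allConfigs zero    m = (λ ()) ∷ []
allConfigs (suc k) m =
  concatMap (λ a → map (consF a) (allConfigs k m)) (choices m)

probChoice : ∀ {n} → Graph n → (Fin n → ℚ) → Fin n → Maybe (Fin n) → ℚ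
probChoice G θ w ch with deg G w | ch
... | zero  | nothing = 1ℚ
... | zero  | just _  = 0ℚ
... | suc k | nothing = 1ℚ - θ w
... | suc k | just u  = if adj G u w then θ w * ((+ 1) / suc k) else 0ℚ

prodℚ : List ℚ → ℚ
prodℚ = foldr _*_ 1ℚ

sumℚ : List ℚ → ℚ
sumℚ = foldr _+_ 0ℚ

probConfig : ∀ {n} → Graph n → (Fin n → ℚ) → Config n → ℚ
probConfig {n} G θ c = prodℚ (map (λ w → probChoice G θ w (c w)) (allFinL n))

live : ∀ {n} → Config n → Fin n → Fin n → Bool
live c x y with c y
... | nothing = false
... | just u  = ⌊ u ≟ x ⌋

anyB : ∀ {n} → (Fin n → Bool) → Bool
anyB {n} p = foldr _∨_ false (map p (allFinL n))

step : ∀ {n} → Config n → (Fin n → Bool) → (Fin n → Bool)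
step c R y = R y ∨ anyB (λ x → R x Data.Bool.∧ live c x y)

iter : ∀ {n} → ℕ → Config n → (Fin n → Bool) → (Fin n → Bool)
iter zero    c R = R
iter (suc k) c R = step c (iter k c R)

-- vertices reachable from the seed set S via directed paths of live edges
-- (n closure steps suffice, since a path visits at most n vertices)
infected : ∀ {n} → Config n → (Fin n → Bool) → (Fin n → Bool)
infected {n} c S = iter n c S

σ : ∀ {n} → Graph n → (Fin n → ℚ) → (Fin n → Bool) → ℚ
σ {n} G θ S =
  sumℚ (map (λ c → probConfig G θ c * ((+ countB (infected c S)) / 1))
            (allConfigs n n))

singleton : ∀ {n} → Fin n → (Fin n → Bool)
singleton v u = ⌊ v ≟ u ⌋

{-# OPTIONS --safe #-}
module Submission where

-- Let R_k(A, v) be the set of vertices reached from v by live paths of length at most k whose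
-- vertices after v lie in A. By induction on k, E|R_k(A, v)| ≤ 1 + deg_A(v). A vertex y ≠ v of
-- R_{k+1}(A, v) lies in R_k(A ∖ v, u), where u is the vertex following the last visit of v on a
-- path to y: a neighbour of v in A whose live incoming edge comes from v. The set R_k(A ∖ v, u)
-- does not depend on the choice made by u, so by independence u contributes at most
-- P(u picks v) · (1 + deg_{A∖v}(u)) ≤ θ_u / deg(u) · deg(u) ≤ 1, because v is a neighbour of u
-- outside A ∖ v. Summing over the neighbours of v in A gives the bound; A = V and k = n give
-- the theorem.

open import Defs
open import Algebra.Bundles using (CommutativeMonoid; CommutativeRing)
open import Data.Bool using (Bool; true; false; T; not; _∧_; _∨_; if_then_else_)
open import Data.Bool.Properties using (T-∧; T-∨; T-≡)
open import Data.Empty using (⊥-elim)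
open import Data.Fin using (Fin; zero; suc; punchIn; _≟_)
open import Data.Fin.Properties using (punchInᵢ≢i)
open import Data.Integer using (+_)
import Data.Integer as ℤ
import Data.Integer.Properties as ℤ
open import Data.List using (List; []; _∷_; _++_; foldr; map; concatMap; tabulate)
  renaming (allFin to allFinL)
import Data.List.Properties as List
open import Data.List.Membership.Propositional using (lose)
open import Data.List.Membership.Propositional.Properties using (∈-allFin)
open import Data.List.Relation.Unary.Any using (satisfied)
open import Data.List.Relation.Unary.Any.Properties using (any⁺; any⁻)
open import Data.Maybe using (Maybe; just; nothing)
open import Data.Nat using (ℕ; zero; suc)
import Data.Nat.ListAction as ℕ
open import Data.Nat.Coprimality using (1-coprimeTo) renaming (sym to coprime-sym)
open import Data.Product as Product using (∃; _×_; _,_; proj₁; proj₂)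
open import Data.Rational
  using (ℚ; 0ℚ; 1ℚ; _≤_; _/_; _+_; _*_; _-_; -_; 1/_; mkℚ; nonNegative)
import Data.Rational.Properties as ℚ
open import Data.Sum using (_⊎_; inj₁; inj₂)
open import Function using (_∘_; id; Equivalence)
open import Relation.Binary.PropositionalEquality
open import Relation.Nullary using (¬_; yes; no)
open import Relation.Nullary.Decidable
  using (⌊_⌋; toWitness; fromWitness; toWitnessFalse; fromWitnessFalse)

open import Algebra.Properties.Semiring.Sum (CommutativeRing.semiring ℚ.+-*-commutativeRing)
  using (sum; sum-cong-≗; sum-replicate-zero; sum-remove; ∑-distrib-+; ∑-comm; *-distribˡ-sum)
open import Algebra.Properties.CommutativeSemigroup
  (CommutativeMonoid.commutativeSemigroup ℚ.*-1-commutativeMonoid)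
  using (x∙yz≈y∙xz)
open import Algebra.Properties.CommutativeSemigroup
  (CommutativeMonoid.commutativeSemigroup ℚ.+-0-commutativeMonoid)
  using () renaming (interchange to +-interchange)
open Equivalence using (to; from)
open ℚ.≤-Reasoning

0≤1 : 0ℚ ≤ 1ℚ
0≤1 = ℚ.≤ᵇ⇒≤ _

-- Typechecks because the closed term 0ℚ + 0ℚ normalises to 0ℚ.
+-nonNeg : ∀ {p q} → 0ℚ ≤ p → 0ℚ ≤ q → 0ℚ ≤ p + q
+-nonNeg = ℚ.+-mono-≤

*-nonNeg : ∀ {p q} → 0ℚ ≤ p → 0ℚ ≤ q → 0ℚ ≤ p * q
*-nonNeg {p} {q} 0≤p 0≤q =
  ℚ.nonNegative⁻¹ (p * q) {{ℚ.nonNeg*nonNeg⇒nonNeg p {{nonNegative 0≤p}} q {{nonNegative 0≤q}}}}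

*-monoˡ-≤ : ∀ {r p q} → 0ℚ ≤ r → p ≤ q → r * p ≤ r * q
*-monoˡ-≤ {r} 0≤r = ℚ.*-monoˡ-≤-nonNeg r {{nonNegative 0≤r}}

*-monoʳ-≤ : ∀ {r p q} → 0ℚ ≤ r → p ≤ q → p * r ≤ q * r
*-monoʳ-≤ {r} 0≤r = ℚ.*-monoʳ-≤-nonNeg r {{nonNegative 0≤r}}

p≤p+q : ∀ {p q} → 0ℚ ≤ q → p ≤ p + q
p≤p+q {p} {q} 0≤q = subst (_≤ p + q) (ℚ.+-identityʳ p) (ℚ.+-monoʳ-≤ p 0≤q)

p≤q+p : ∀ {p q} → 0ℚ ≤ q → p ≤ q + p
p≤q+p {p} {q} 0≤q = subst (p ≤_) (ℚ.+-comm p q) (p≤p+q 0≤q)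

/1-suc : ∀ s → (+ suc s) / 1 ≡ 1ℚ + (+ s) / 1
/1-suc s = begin-equality
  (+ suc s) / 1          ≡⟨ cong (λ i → (+ 1 ℤ.+ i) / 1) (ℤ.*-identityʳ (+ s)) ⟨
  1ℚ + mkℚ (+ s) 0 s/1   ≡⟨ cong (_+_ 1ℚ) (ℚ.↥p/↧p≡p (mkℚ (+ s) 0 s/1)) ⟨
  1ℚ + (+ s) / 1         ∎
  where
  s/1 = coprime-sym (1-coprimeTo s)

p*1/n*n≡p : ∀ p d → p * ((+ 1) / suc d) * ((+ suc d) / 1) ≡ p
p*1/n*n≡p p d = begin-equality
  p * 1/n * n    ≡⟨ ℚ.*-assoc p 1/n n ⟩
  p * (1/n * n)  ≡⟨ cong (_*_ p) (ℚ.*-comm 1/n n) ⟩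
  p * (n * 1/n)  ≡⟨ cong (_*_ p) n*1/n≡1 ⟩
  p * 1ℚ         ≡⟨ ℚ.*-identityʳ p ⟩
  p              ∎
  where
  1/n n n′ : ℚ
  1/n = (+ 1) / suc d
  n   = (+ suc d) / 1
  n′  = mkℚ (+ suc d) 0 (coprime-sym (1-coprimeTo (suc d)))
  n*1/n≡1 : n * 1/n ≡ 1ℚ
  n*1/n≡1 = trans (cong₂ _*_ (ℚ.↥p/↧p≡p n′) (ℚ.↥p/↧p≡p (1/ n′))) (ℚ.*-inverseʳ n′)

sum-mono-≤ : ∀ {n} {f g : Fin n → ℚ} → (∀ i → f i ≤ g i) → sum f ≤ sum g
sum-mono-≤ {zero}  _   = ℚ.≤-refl
sum-mono-≤ {suc n} f≤g = ℚ.+-mono-≤ (f≤g zero) (sum-mono-≤ (f≤g ∘ suc))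

sum-nonNeg : ∀ {n} {f : Fin n → ℚ} → (∀ i → 0ℚ ≤ f i) → 0ℚ ≤ sum f
sum-nonNeg {zero}  _   = ℚ.≤-refl
sum-nonNeg {suc n} 0≤f = +-nonNeg (0≤f zero) (sum-nonNeg (0≤f ∘ suc))

term≤sum : ∀ {n} {f : Fin n → ℚ} → (∀ i → 0ℚ ≤ f i) → ∀ i → f i ≤ sum f
term≤sum {suc n} {f} 0≤f i = begin
  f i                       ≤⟨ p≤p+q (sum-nonNeg (0≤f ∘ punchIn i)) ⟩
  f i + sum (f ∘ punchIn i) ≡⟨ sum-remove {i = i} f ⟨
  sum f                     ∎

sum-single : ∀ {n} {f : Fin n → ℚ} i → (∀ j → i ≢ j → f j ≡ 0ℚ) → sum f ≡ f i
sum-single {suc n} {f} i f≡0 = begin-equality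
  sum f                     ≡⟨ sum-remove {i = i} f ⟩
  f i + sum (f ∘ punchIn i) ≡⟨ cong (_+_ (f i)) others≡0 ⟩
  f i + 0ℚ                  ≡⟨ ℚ.+-identityʳ (f i) ⟩
  f i                       ∎
  where
  others≡0 : sum (f ∘ punchIn i) ≡ 0ℚ
  others≡0 = trans (sum-cong-≗ (λ j → f≡0 _ (punchInᵢ≢i i j ∘ sym))) (sum-replicate-zero n)

𝟙 : Bool → ℚ
𝟙 true  = 1ℚ
𝟙 false = 0ℚ

𝟙-nonNeg : ∀ b → 0ℚ ≤ 𝟙 b
𝟙-nonNeg true  = 0≤1
𝟙-nonNeg false = ℚ.≤-refl

𝟙-true : ∀ {b} → T b → 𝟙 b ≡ 1ℚ
𝟙-true {true} _ = refl

𝟙-false : ∀ {b} → ¬ T b → 𝟙 b ≡ 0ℚ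
𝟙-false {false} _  = refl
𝟙-false {true}  ¬⊤ = ⊥-elim (¬⊤ _)

𝟙-∧ : ∀ a b → 𝟙 (a ∧ b) ≡ 𝟙 a * 𝟙 b
𝟙-∧ true  b = sym (ℚ.*-identityˡ (𝟙 b))
𝟙-∧ false b = sym (ℚ.*-zeroˡ (𝟙 b))

if-then-0≡*𝟙 : ∀ b r → (if b then r else 0ℚ) ≡ r * 𝟙 b
if-then-0≡*𝟙 true  r = sym (ℚ.*-identityʳ r)
if-then-0≡*𝟙 false r = sym (ℚ.*-zeroʳ r)

𝟙-≤ : ∀ {b x} → 0ℚ ≤ x → (T b → 1ℚ ≤ x) → 𝟙 b ≤ x
𝟙-≤ {false} 0≤x _   = 0≤x
𝟙-≤ {true}  _   1≤x = 1≤x _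

𝟙-mono : ∀ {a b} → (T a → T b) → 𝟙 a ≤ 𝟙 b
𝟙-mono {b = b} a⇒b = 𝟙-≤ (𝟙-nonNeg b) (ℚ.≤-reflexive ∘ sym ∘ 𝟙-true ∘ a⇒b)

𝟙-+-≤ : ∀ {r s u} → (T r → T u) → (T s → T u) → (T r → ¬ T s) → 𝟙 r + 𝟙 s ≤ 𝟙 u
𝟙-+-≤ {false} {s}   _   s⇒u _   = subst (_≤ _) (sym (ℚ.+-identityˡ (𝟙 s))) (𝟙-mono s⇒u)
𝟙-+-≤ {true}  {false} r⇒u _ _   = 𝟙-mono r⇒u
𝟙-+-≤ {true}  {true}  _   _ r#s = ⊥-elim (r#s _ _)

card : ∀ {n} → (Fin n → Bool) → ℚ
card p = sum (𝟙 ∘ p)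

countB≡card : ∀ {n} (p : Fin n → Bool) → (+ countB p) / 1 ≡ card p
countB≡card {n} p = along id
  where
  countAlong : ∀ {k} → (Fin k → Fin n) → ℕ
  countAlong g = ℕ.sum (map (λ u → if p u then 1 else 0) (tabulate g))
  along : ∀ {k} (g : Fin k → Fin n) → (+ countAlong g) / 1 ≡ card (p ∘ g)
  along {zero}  g = refl
  along {suc k} g with p (g zero)
  ... | true  = trans (/1-suc (countAlong (g ∘ suc))) (cong (_+_ 1ℚ) (along (g ∘ suc)))
  ... | false = trans (along (g ∘ suc)) (sym (ℚ.+-identityˡ _))

card-singleton : ∀ {n} (v : Fin n) → card (singleton v) ≡ 1ℚ
card-singleton v = trans (sum-single v (λ j v≢j → 𝟙-false {⌊ v ≟ j ⌋} (v≢j ∘ toWitness)))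
                         (𝟙-true {⌊ v ≟ v ⌋} (fromWitness refl))

card-∧ˡ : ∀ {n} b (p : Fin n → Bool) → card (λ y → b ∧ p y) ≡ 𝟙 b * card p
card-∧ˡ b p = trans (sum-cong-≗ (λ y → 𝟙-∧ b (p y))) (sym (*-distribˡ-sum (𝟙 b) (𝟙 ∘ p)))

card-disjoint-≤ : ∀ {n} {R S U : Fin n → Bool} →
  (∀ y → T (R y) → T (U y)) → (∀ y → T (S y) → T (U y)) → (∀ y → T (R y) → ¬ T (S y)) →
  card R + card S ≤ card U
card-disjoint-≤ {R = R} {S} {U} R⊆U S⊆U R#S = begin
  card R + card S                ≡⟨ ∑-distrib-+ (𝟙 ∘ R) (𝟙 ∘ S) ⟨
  sum (λ y → 𝟙 (R y) + 𝟙 (S y)) ≤⟨ sum-mono-≤ (λ y → 𝟙-+-≤ (R⊆U y) (S⊆U y) (R#S y)) ⟩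
  card U                         ∎

card-cover : ∀ {m n} (R S : Fin n → Bool) (P : Fin m → Fin n → Bool) →
  (∀ y → T (R y) → T (S y) ⊎ ∃ λ u → T (P u y)) →
  card R ≤ card S + sum (λ u → card (P u))
card-cover R S P cover = begin
  card R                                        ≤⟨ sum-mono-≤ pointwise ⟩
  sum (λ y → 𝟙 (S y) + sum (λ u → 𝟙 (P u y))) ≡⟨ ∑-distrib-+ (𝟙 ∘ S) _ ⟩
  card S + sum (λ y → sum (λ u → 𝟙 (P u y)))
    ≡⟨ cong (_+_ (card S)) (∑-comm (λ y u → 𝟙 (P u y))) ⟩
  card S + sum (λ u → card (P u))               ∎
  where
  pointwise : ∀ y → 𝟙 (R y) ≤ 𝟙 (S y) + sum (λ u → 𝟙 (P u y))
  pointwise y = 𝟙-≤ (+-nonNeg (𝟙-nonNeg (S y)) others-nonNeg) (covered ∘ cover y)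
    where
    others-nonNeg : 0ℚ ≤ sum (λ u → 𝟙 (P u y))
    others-nonNeg = sum-nonNeg (λ u → 𝟙-nonNeg (P u y))
    covered : T (S y) ⊎ ∃ (λ u → T (P u y)) → 1ℚ ≤ 𝟙 (S y) + sum (λ u → 𝟙 (P u y))
    covered (inj₁ Sy) = begin
      1ℚ                               ≡⟨ 𝟙-true Sy ⟨
      𝟙 (S y)                          ≤⟨ p≤p+q others-nonNeg ⟩
      𝟙 (S y) + sum (λ u → 𝟙 (P u y)) ∎
    covered (inj₂ (u , Puy)) = begin
      1ℚ                               ≡⟨ 𝟙-true Puy ⟨
      𝟙 (P u y)                        ≤⟨ term≤sum (λ u → 𝟙-nonNeg (P u y)) u ⟩
      sum (λ u → 𝟙 (P u y))            ≤⟨ p≤q+p (𝟙-nonNeg (S y)) ⟩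
      𝟙 (S y) + sum (λ u → 𝟙 (P u y)) ∎

module _ {A : Set} where

  sumℚ-map-++ : (f : A → ℚ) (xs ys : List A) →
                sumℚ (map f (xs ++ ys)) ≡ sumℚ (map f xs) + sumℚ (map f ys)
  sumℚ-map-++ f []       ys = sym (ℚ.+-identityˡ _)
  sumℚ-map-++ f (x ∷ xs) ys =
    trans (cong (_+_ (f x)) (sumℚ-map-++ f xs ys)) (sym (ℚ.+-assoc (f x) _ _))

  sumℚ-map-+ : (f g : A → ℚ) (xs : List A) →
               sumℚ (map (λ x → f x + g x) xs) ≡ sumℚ (map f xs) + sumℚ (map g xs)
  sumℚ-map-+ f g []       = refl
  sumℚ-map-+ f g (x ∷ xs) =
    trans (cong (_+_ (f x + g x)) (sumℚ-map-+ f g xs)) (+-interchange (f x) (g x) _ _)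

  *-distribˡ-sumℚ : (r : ℚ) (f : A → ℚ) (xs : List A) →
                    r * sumℚ (map f xs) ≡ sumℚ (map (λ x → r * f x) xs)
  *-distribˡ-sumℚ r f []       = ℚ.*-zeroʳ r
  *-distribˡ-sumℚ r f (x ∷ xs) =
    trans (ℚ.*-distribˡ-+ r (f x) _) (cong (_+_ (r * f x)) (*-distribˡ-sumℚ r f xs))

  sumℚ-map-mono : {f g : A → ℚ} (xs : List A) → (∀ x → f x ≤ g x) →
                  sumℚ (map f xs) ≤ sumℚ (map g xs)
  sumℚ-map-mono []       _   = ℚ.≤-refl
  sumℚ-map-mono (x ∷ xs) f≤g = ℚ.+-mono-≤ (f≤g x) (sumℚ-map-mono xs f≤g)

  sumℚ-map-∑ : ∀ {n} (f : A → Fin n → ℚ) (xs : List A) →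
               sumℚ (map (λ x → sum (f x)) xs) ≡ sum (λ u → sumℚ (map (λ x → f x u) xs))
  sumℚ-map-∑ {n} f []       = sym (sum-replicate-zero n)
  sumℚ-map-∑     f (x ∷ xs) =
    trans (cong (_+_ (sum (f x))) (sumℚ-map-∑ f xs)) (sym (∑-distrib-+ (f x) _))

  prodℚ-nonNeg : {f : A → ℚ} (xs : List A) → (∀ x → 0ℚ ≤ f x) → 0ℚ ≤ prodℚ (map f xs)
  prodℚ-nonNeg []       _   = 0≤1
  prodℚ-nonNeg (x ∷ xs) 0≤f = *-nonNeg (0≤f x) (prodℚ-nonNeg xs 0≤f)

sumℚ-concatMap : ∀ {A B : Set} (f : B → ℚ) (g : A → List B) (xs : List A) →
                 sumℚ (map f (concatMap g xs)) ≡ sumℚ (map (λ a → sumℚ (map f (g a))) xs)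
sumℚ-concatMap f g []       = refl
sumℚ-concatMap f g (x ∷ xs) =
  trans (sumℚ-map-++ f (g x) (concatMap g xs))
        (cong (_+_ (sumℚ (map f (g x)))) (sumℚ-concatMap f g xs))

sumℚ-allFin : ∀ {n} (f : Fin n → ℚ) → sumℚ (map f (allFinL n)) ≡ sum f
sumℚ-allFin {n} f = along id
  where
  along : ∀ {k} (g : Fin k → Fin n) → sumℚ (map f (tabulate g)) ≡ sum (f ∘ g)
  along {zero}  g = refl
  along {suc k} g = cong (_+_ (f (g zero))) (along (g ∘ suc))

-- Expectation over configurations

Cfg : ℕ → ℕ → Set
Cfg k m = Fin k → Maybe (Fin m)

weight : ∀ {k m} → (Fin k → Maybe (Fin m) → ℚ) → Cfg k m → ℚ
weight {k} q c = prodℚ (map (λ w → q w (c w)) (allFinL k))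

𝔼 : ∀ {k m} → (Fin k → Maybe (Fin m) → ℚ) → (Cfg k m → ℚ) → ℚ
𝔼 {k} {m} q f = sumℚ (map (λ c → weight q c * f c) (allConfigs k m))

sumChoices : ∀ {m} → (Maybe (Fin m) → ℚ) → ℚ
sumChoices {m} g = sumℚ (map g (choices m))

module _ {m : ℕ} where

  sumChoices-cong : {g h : Maybe (Fin m) → ℚ} → (∀ a → g a ≡ h a) → sumChoices g ≡ sumChoices h
  sumChoices-cong g≡h = cong sumℚ (List.map-cong g≡h (choices m))

  sumChoices-*ˡ : (r : ℚ) (g : Maybe (Fin m) → ℚ) →
                  sumChoices (λ a → r * g a) ≡ r * sumChoices g
  sumChoices-*ˡ r g = sym (*-distribˡ-sumℚ r g (choices m))

  sumChoices-*ʳ : (g : Maybe (Fin m) → ℚ) (r : ℚ) →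
                  sumChoices (λ a → g a * r) ≡ sumChoices g * r
  sumChoices-*ʳ g r = begin-equality
    sumChoices (λ a → g a * r) ≡⟨ sumChoices-cong (λ a → ℚ.*-comm (g a) r) ⟩
    sumChoices (λ a → r * g a) ≡⟨ sumChoices-*ˡ r g ⟩
    r * sumChoices g           ≡⟨ ℚ.*-comm r _ ⟩
    sumChoices g * r           ∎

  sumChoices-split : (g : Maybe (Fin m) → ℚ) → sumChoices g ≡ g nothing + sum (g ∘ just)
  sumChoices-split g = cong (_+_ (g nothing))
    (trans (cong sumℚ (sym (List.map-∘ (allFinL m)))) (sumℚ-allFin (g ∘ just)))

selects : ∀ {n} → Maybe (Fin n) → Fin n → Bool
selects nothing  x = false
selects (just u) x = ⌊ u ≟ x ⌋

live≡selects : ∀ {n} (c : Config n) x y → live c x y ≡ selects (c y) x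
live≡selects c x y with c y
... | nothing = refl
... | just u  = refl

sumChoices-selects : ∀ {m} (g : Maybe (Fin m) → ℚ) v →
                     sumChoices (λ a → g a * 𝟙 (selects a v)) ≡ g (just v)
sumChoices-selects g v = begin-equality
  sumChoices (λ a → g a * 𝟙 (selects a v))
    ≡⟨ sumChoices-split (λ a → g a * 𝟙 (selects a v)) ⟩
  g nothing * 0ℚ + sum (λ x → g (just x) * 𝟙 ⌊ x ≟ v ⌋)
    ≡⟨ cong₂ _+_ (ℚ.*-zeroʳ (g nothing)) (sum-single v off-v) ⟩
  0ℚ + g (just v) * 𝟙 ⌊ v ≟ v ⌋
    ≡⟨ ℚ.+-identityˡ _ ⟩
  g (just v) * 𝟙 ⌊ v ≟ v ⌋
    ≡⟨ cong (_*_ (g (just v))) (𝟙-true {⌊ v ≟ v ⌋} (fromWitness refl)) ⟩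
  g (just v) * 1ℚ
    ≡⟨ ℚ.*-identityʳ _ ⟩
  g (just v) ∎
  where
  off-v : ∀ x → v ≢ x → g (just x) * 𝟙 ⌊ x ≟ v ⌋ ≡ 0ℚ
  off-v x v≢x = trans (cong (_*_ (g (just x))) (𝟙-false {⌊ x ≟ v ⌋} (v≢x ∘ sym ∘ toWitness)))
                      (ℚ.*-zeroʳ (g (just x)))

module _ {k m : ℕ} (q : Fin k → Maybe (Fin m) → ℚ) where

  private
    each : {f g : Cfg k m → ℚ} → (∀ c → f c ≡ g c) →
           sumℚ (map f (allConfigs k m)) ≡ sumℚ (map g (allConfigs k m))
    each f≡g = cong sumℚ (List.map-cong f≡g (allConfigs k m))

  𝔼-cong : {f g : Cfg k m → ℚ} → (∀ c → f c ≡ g c) → 𝔼 q f ≡ 𝔼 q g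
  𝔼-cong f≡g = each (λ c → cong (_*_ (weight q c)) (f≡g c))

  𝔼-+ : (f g : Cfg k m → ℚ) → 𝔼 q (λ c → f c + g c) ≡ 𝔼 q f + 𝔼 q g
  𝔼-+ f g = trans (each (λ c → ℚ.*-distribˡ-+ (weight q c) (f c) (g c)))
                  (sumℚ-map-+ _ _ (allConfigs k m))

  𝔼-*ˡ : (r : ℚ) (f : Cfg k m → ℚ) → 𝔼 q (λ c → r * f c) ≡ r * 𝔼 q f
  𝔼-*ˡ r f = trans (each (λ c → x∙yz≈y∙xz (weight q c) r (f c)))
                   (sym (*-distribˡ-sumℚ r _ (allConfigs k m)))

  𝔼-∑ : ∀ {n} (f : Fin n → Cfg k m → ℚ) →
        𝔼 q (λ c → sum (λ u → f u c)) ≡ sum (λ u → 𝔼 q (f u))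
  𝔼-∑ f = trans (each (λ c → *-distribˡ-sum (weight q c) (λ u → f u c)))
                (sumℚ-map-∑ (λ c u → weight q c * f u c) (allConfigs k m))

  𝔼-mono : (∀ w a → 0ℚ ≤ q w a) → {f g : Cfg k m → ℚ} → (∀ c → f c ≤ g c) → 𝔼 q f ≤ 𝔼 q g
  𝔼-mono 0≤q f≤g = sumℚ-map-mono (allConfigs k m)
    (λ c → *-monoˡ-≤ (prodℚ-nonNeg (allFinL k) (λ w → 0≤q w (c w))) (f≤g c))

weight-consF : ∀ {k m} (q : Fin (suc k) → Maybe (Fin m) → ℚ) a (c : Cfg k m) →
               weight q (consF a c) ≡ q zero a * weight (q ∘ suc) c
weight-consF q a c = cong (λ ws → q zero a * prodℚ ws)
  (trans (List.map-tabulate suc _) (sym (List.map-tabulate id (λ w → q (suc w) (c w)))))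

𝔼-suc : ∀ {k m} (q : Fin (suc k) → Maybe (Fin m) → ℚ) (f : Cfg (suc k) m → ℚ) →
        𝔼 q f ≡ sumChoices (λ a → q zero a * 𝔼 (q ∘ suc) (f ∘ consF a))
𝔼-suc {k} {m} q f = trans
  (sumℚ-concatMap (λ c → weight q c * f c) (λ a → map (consF a) (allConfigs k m)) (choices m))
  (sumChoices-cong fix-first)
  where
  fix-first : ∀ a → sumℚ (map (λ c → weight q c * f c) (map (consF a) (allConfigs k m)))
                    ≡ q zero a * 𝔼 (q ∘ suc) (f ∘ consF a)
  fix-first a = begin-equality
    sumℚ (map (λ c → weight q c * f c) (map (consF a) (allConfigs k m)))
      ≡⟨ cong sumℚ (List.map-∘ (allConfigs k m)) ⟨
    sumℚ (map (λ c → weight q (consF a c) * f (consF a c)) (allConfigs k m))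
      ≡⟨ cong sumℚ (List.map-cong factor-first (allConfigs k m)) ⟩
    sumℚ (map (λ c → q zero a * (weight (q ∘ suc) c * f (consF a c))) (allConfigs k m))
      ≡⟨ *-distribˡ-sumℚ (q zero a) _ (allConfigs k m) ⟨
    q zero a * 𝔼 (q ∘ suc) (f ∘ consF a) ∎
    where
    factor-first : ∀ c → weight q (consF a c) * f (consF a c)
                         ≡ q zero a * (weight (q ∘ suc) c * f (consF a c))
    factor-first c = trans (cong (_* f (consF a c)) (weight-consF q a c))
                           (ℚ.*-assoc (q zero a) _ _)

𝔼-const-1 : ∀ {k m} (q : Fin k → Maybe (Fin m) → ℚ) →
            (∀ w → sumChoices (q w) ≡ 1ℚ) → 𝔼 q (λ _ → 1ℚ) ≡ 1ℚ
𝔼-const-1 {zero}  q _     = refl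
𝔼-const-1 {suc k} q total = begin-equality
  𝔼 q (λ _ → 1ℚ)                                       ≡⟨ 𝔼-suc q _ ⟩
  sumChoices (λ a → q zero a * 𝔼 (q ∘ suc) (λ _ → 1ℚ))
    ≡⟨ sumChoices-cong (λ a → cong (_*_ (q zero a)) IH) ⟩
  sumChoices (λ a → q zero a * 1ℚ)                     ≡⟨ sumChoices-cong (ℚ.*-identityʳ ∘ q zero) ⟩
  sumChoices (q zero)                                  ≡⟨ total zero ⟩
  1ℚ                                                   ∎
  where
  IH : 𝔼 (q ∘ suc) (λ _ → 1ℚ) ≡ 1ℚ
  IH = 𝔼-const-1 (q ∘ suc) (total ∘ suc)

IgnoresCoordinate : ∀ {k m} → Fin k → (Cfg k m → ℚ) → Set
IgnoresCoordinate u F = ∀ {c c′} → (∀ w → u ≢ w → c w ≡ c′ w) → F c ≡ F c′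

𝔼-independent : ∀ {k m} (q : Fin k → Maybe (Fin m) → ℚ) u
  (h : Maybe (Fin m) → ℚ) (F : Cfg k m → ℚ) →
  IgnoresCoordinate u F → sumChoices (q u) ≡ 1ℚ →
  𝔼 q (λ c → h (c u) * F c) ≡ sumChoices (λ a → q u a * h a) * 𝔼 q F
𝔼-independent {suc k} {m} q zero h F F-ignores total = begin-equality
  𝔼 q (λ c → h (c zero) * F c)
    ≡⟨ 𝔼-suc q _ ⟩
  sumChoices (λ a → q zero a * 𝔼 q′ (λ c → h a * F (consF a c)))
    ≡⟨ sumChoices-cong (λ a → cong (_*_ (q zero a)) (𝔼-factor a)) ⟩
  sumChoices (λ a → q zero a * (h a * 𝔼 q′ F₀))
    ≡⟨ sumChoices-cong (λ a → sym (ℚ.*-assoc (q zero a) (h a) _)) ⟩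
  sumChoices (λ a → q zero a * h a * 𝔼 q′ F₀)
    ≡⟨ sumChoices-*ʳ (λ a → q zero a * h a) _ ⟩
  sumChoices (λ a → q zero a * h a) * 𝔼 q′ F₀
    ≡⟨ cong (_*_ (sumChoices (λ a → q zero a * h a))) 𝔼F≡𝔼F₀ ⟨
  sumChoices (λ a → q zero a * h a) * 𝔼 q F
    ∎
  where
  q′ : Fin k → Maybe (Fin m) → ℚ
  q′ = q ∘ suc
  F₀ : Cfg k m → ℚ
  F₀ c = F (consF nothing c)
  F-ignores-first : ∀ a c → F (consF a c) ≡ F₀ c
  F-ignores-first a c = F-ignores λ { zero 0≢0 → ⊥-elim (0≢0 refl) ; (suc w) _ → refl }
  𝔼-factor : ∀ a → 𝔼 q′ (λ c → h a * F (consF a c)) ≡ h a * 𝔼 q′ F₀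
  𝔼-factor a = trans (𝔼-cong q′ (cong (_*_ (h a)) ∘ F-ignores-first a)) (𝔼-*ˡ q′ (h a) F₀)
  𝔼F≡𝔼F₀ : 𝔼 q F ≡ 𝔼 q′ F₀
  𝔼F≡𝔼F₀ = begin-equality
    𝔼 q F                                             ≡⟨ 𝔼-suc q F ⟩
    sumChoices (λ a → q zero a * 𝔼 q′ (F ∘ consF a))
      ≡⟨ sumChoices-cong (λ a → cong (_*_ (q zero a)) (𝔼-cong q′ (F-ignores-first a))) ⟩
    sumChoices (λ a → q zero a * 𝔼 q′ F₀)            ≡⟨ sumChoices-*ʳ (q zero) _ ⟩
    sumChoices (q zero) * 𝔼 q′ F₀                    ≡⟨ cong (_* 𝔼 q′ F₀) total ⟩
    1ℚ * 𝔼 q′ F₀                                     ≡⟨ ℚ.*-identityˡ _ ⟩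
    𝔼 q′ F₀                                          ∎
𝔼-independent {suc k} {m} q (suc u) h F F-ignores total = begin-equality
  𝔼 q (λ c → h (c (suc u)) * F c)
    ≡⟨ 𝔼-suc q _ ⟩
  sumChoices (λ a → q zero a * 𝔼 q′ (λ c → h (c u) * F (consF a c)))
    ≡⟨ sumChoices-cong (λ a → cong (_*_ (q zero a)) (IH a)) ⟩
  sumChoices (λ a → q zero a * (K * 𝔼 q′ (F ∘ consF a)))
    ≡⟨ sumChoices-cong (λ a → x∙yz≈y∙xz (q zero a) K _) ⟩
  sumChoices (λ a → K * (q zero a * 𝔼 q′ (F ∘ consF a)))
    ≡⟨ sumChoices-*ˡ K (λ a → q zero a * 𝔼 q′ (F ∘ consF a)) ⟩
  K * sumChoices (λ a → q zero a * 𝔼 q′ (F ∘ consF a))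
    ≡⟨ cong (_*_ K) (𝔼-suc q F) ⟨
  K * 𝔼 q F
    ∎
  where
  q′ : Fin k → Maybe (Fin m) → ℚ
  q′ = q ∘ suc
  K : ℚ
  K = sumChoices (λ a → q (suc u) a * h a)
  F-ignores-rest : ∀ a → IgnoresCoordinate u (F ∘ consF a)
  F-ignores-rest a agree =
    F-ignores λ { zero _ → refl ; (suc w) su≢sw → agree w (su≢sw ∘ cong suc) }
  IH : ∀ a → 𝔼 q′ (λ c → h (c u) * F (consF a c)) ≡ K * 𝔼 q′ (F ∘ consF a)
  IH a = 𝔼-independent q′ u h (F ∘ consF a) (F-ignores-rest a) total

-- Reachability along live edges

anyB-witness : ∀ {n} {p : Fin n → Bool} → T (anyB p) → ∃ λ x → T (p x)
anyB-witness {n} {p} = satisfied ∘ any⁻ p (allFinL n)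

anyB-intro : ∀ {n} {p : Fin n → Bool} x → T (p x) → T (anyB p)
anyB-intro {p = p} x = any⁺ p ∘ lose (∈-allFin x)

anyB-cong : ∀ {n} {p p′ : Fin n → Bool} → (∀ x → p x ≡ p′ x) → anyB p ≡ anyB p′
anyB-cong {n} p≡p′ = cong (foldr _∨_ false) (List.map-cong p≡p′ (allFinL n))

live-cong : ∀ {n} {c c′ : Config n} x y → c y ≡ c′ y → live c x y ≡ live c′ x y
live-cong {c = c} {c′} x y cy≡c′y =
  trans (live≡selects c x y) (trans (cong (λ a → selects a x) cy≡c′y) (sym (live≡selects c′ x y)))

_∖_ : ∀ {n} → (Fin n → Bool) → Fin n → (Fin n → Bool)
(A ∖ v) w = A w ∧ not ⌊ v ≟ w ⌋

∖-intro : ∀ {n} (A : Fin n → Bool) {v w} → T (A w) → v ≢ w → T ((A ∖ v) w)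
∖-intro A {w = w} Aw v≢w = from (T-∧ {A w}) (Aw , fromWitnessFalse v≢w)

∖-elim : ∀ {n} (A : Fin n → Bool) {v w} → T ((A ∖ v) w) → T (A w) × v ≢ w
∖-elim A {v} {w} w∈ = Product.map₂ (toWitnessFalse {a? = v ≟ w}) (to (T-∧ {A w}) w∈)

-- reach k A c v is R_k(A, v) in the configuration c.
reach : ∀ {n} → ℕ → (Fin n → Bool) → Config n → Fin n → (Fin n → Bool)
reach zero    A c v y = singleton v y
reach (suc k) A c v y = reach k A c v y ∨ (A y ∧ anyB (λ x → reach k A c v x ∧ live c x y))

reach-everywhere≡iter : ∀ {n} k (c : Config n) v → reach k (λ _ → true) c v ≡ iter k c (singleton v)
reach-everywhere≡iter zero    c v = refl
reach-everywhere≡iter (suc k) c v = cong (step c) (reach-everywhere≡iter k c v)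

module _ {n} {A : Fin n → Bool} {c : Config n} {v : Fin n} where

  reach-suc⁺ : ∀ {k y} → T (reach k A c v y) → T (reach (suc k) A c v y)
  reach-suc⁺ {k} {y} y∈ = from (T-∨ {reach k A c v y}) (inj₁ y∈)

  reach-start : ∀ k → T (reach k A c v v)
  reach-start zero    = fromWitness {a? = v ≟ v} refl
  reach-start (suc k) = reach-suc⁺ {k} (reach-start k)

  reach-extend : ∀ {k x y} → T (reach k A c v x) → T (A y) → T (live c x y) →
                 T (reach (suc k) A c v y)
  reach-extend {k} {x} {y} x∈ Ay x→y = from (T-∨ {reach k A c v y})
    (inj₂ (from (T-∧ {A y}) (Ay , anyB-intro x (from (T-∧ {reach k A c v x}) (x∈ , x→y)))))

reach-ignores-start-choice : ∀ k {n} {B : Fin n → Bool} {c c′ : Config n} {u} →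
  (∀ w → u ≢ w → c w ≡ c′ w) → ∀ y → reach k B c u y ≡ reach k B c′ u y
reach-ignores-start-choice zero agree y = refl
reach-ignores-start-choice (suc k) {B = B} {c} {c′} {u} agree y with u ≟ y
... | yes refl = trans (to T-≡ (reach-start {A = B} {c} (suc k)))
                       (sym (to T-≡ (reach-start {A = B} {c′} (suc k))))
... | no  u≢y  = cong₂ _∨_ (IH y) (cong (B y ∧_) (anyB-cong same-edges))
  where
  IH : ∀ y → reach k B c u y ≡ reach k B c′ u y
  IH = reach-ignores-start-choice k agree
  same-edges : ∀ x → (reach k B c u x ∧ live c x y) ≡ (reach k B c′ u x ∧ live c′ x y)
  same-edges x = cong₂ _∧_ (IH x) (live-cong {c = c} {c′} x y (agree y u≢y))

firstHop : ∀ {n} → (Fin n → Bool) → Config n → Fin n → Fin n → Bool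
firstHop A c v u = (A ∖ v) u ∧ live c v u

-- Cut the path at its last visit to v: the next vertex u is a first hop, and the rest avoids v.
reach-suc-split : ∀ k {n} {A : Fin n → Bool} {c v y} → T (reach (suc k) A c v y) →
  v ≡ y ⊎ ∃ λ u → T (firstHop A c v u) × T (reach k (A ∖ v) c u y)
reach-suc-split k {A = A} {c} {v} {y} y∈ with to (T-∨ {reach k A c v y}) y∈
reach-suc-split zero {v = v} {y} _ | inj₁ y∈₀ = inj₁ (toWitness {a? = v ≟ y} y∈₀)
reach-suc-split (suc k) {A = A} {c} {v} _ | inj₁ y∈ₖ with reach-suc-split k y∈ₖ
... | inj₁ v≡y             = inj₁ v≡y
... | inj₂ (u , hop , y∈ᵤ) = inj₂ (u , hop , reach-suc⁺ {A = A ∖ v} {c} {u} {k} y∈ᵤ)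
reach-suc-split k {A = A} {c} {v} {y} _ | inj₂ edge with to (T-∧ {A y}) edge
... | Ay , some-x with anyB-witness some-x
... | x , x-edge with to (T-∧ {reach k A c v x}) x-edge
... | x∈ , x→y with v ≟ y
... | yes v≡y = inj₁ v≡y
... | no  v≢y = inj₂ (via k x∈)
  where
  hop-to-y : v ≡ x → T (firstHop A c v y)
  hop-to-y refl = from (T-∧ {(A ∖ v) y}) (∖-intro A Ay v≢y , x→y)
  via : ∀ j → T (reach j A c v x) → ∃ λ u → T (firstHop A c v u) × T (reach j (A ∖ v) c u y)
  via zero x∈₀ = y , hop-to-y (toWitness {a? = v ≟ x} x∈₀) , reach-start {A = A ∖ v} {c} zero
  via (suc j) x∈ⱼ with reach-suc-split j x∈ⱼ
  ... | inj₁ v≡x             = y , hop-to-y v≡x , reach-start {A = A ∖ v} {c} (suc j)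
  ... | inj₂ (u , hop , x∈ᵤ) =
    u , hop , reach-extend {A = A ∖ v} {c} {u} {j} x∈ᵤ (∖-intro A Ay v≢y) x→y

card-reach-suc≤1+∑ : ∀ k {n} (A : Fin n → Bool) c v →
  card (reach (suc k) A c v) ≤ 1ℚ + sum (λ u → 𝟙 (firstHop A c v u) * card (reach k (A ∖ v) c u))
card-reach-suc≤1+∑ k {n} A c v = begin
  card (reach (suc k) A c v)
    ≤⟨ card-cover (reach (suc k) A c v) (singleton v) hopThenReach split ⟩
  card (singleton v) + sum (λ u → card (hopThenReach u))
    ≡⟨ cong₂ _+_ (card-singleton v) (sum-cong-≗ λ u → card-∧ˡ (firstHop A c v u) (reach k (A ∖ v) c u)) ⟩
  1ℚ + sum (λ u → 𝟙 (firstHop A c v u) * card (reach k (A ∖ v) c u)) ∎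
  where
  hopThenReach : Fin n → Fin n → Bool
  hopThenReach u y = firstHop A c v u ∧ reach k (A ∖ v) c u y
  split : ∀ y → T (reach (suc k) A c v y) → T (singleton v y) ⊎ ∃ λ u → T (hopThenReach u y)
  split y y∈ with reach-suc-split k y∈
  ... | inj₁ v≡y             = inj₁ (fromWitness {a? = v ≟ y} v≡y)
  ... | inj₂ (u , hop , y∈ᵤ) = inj₂ (u , from (T-∧ {firstHop A c v u}) (hop , y∈ᵤ))

𝔼-firstHop : ∀ k {n} (q : Fin n → Maybe (Fin n) → ℚ) (A : Fin n → Bool) v u →
  sumChoices (q u) ≡ 1ℚ →
  𝔼 q (λ c → 𝟙 (firstHop A c v u) * card (reach k (A ∖ v) c u))
    ≡ 𝟙 ((A ∖ v) u) * (q u (just v) * 𝔼 q (λ c → card (reach k (A ∖ v) c u)))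
𝔼-firstHop k {n} q A v u total = begin-equality
  𝔼 q (λ c → 𝟙 (firstHop A c v u) * X c)
    ≡⟨ 𝔼-cong q split-indicator ⟩
  𝔼 q (λ c → 𝟙 ((A ∖ v) u) * (𝟙 (selects (c u) v) * X c))
    ≡⟨ 𝔼-*ˡ q (𝟙 ((A ∖ v) u)) _ ⟩
  𝟙 ((A ∖ v) u) * 𝔼 q (λ c → 𝟙 (selects (c u) v) * X c)
    ≡⟨ cong (_*_ (𝟙 ((A ∖ v) u)))
         (𝔼-independent q u (λ a → 𝟙 (selects a v)) X X-ignores-u total) ⟩
  𝟙 ((A ∖ v) u) * (sumChoices (λ a → q u a * 𝟙 (selects a v)) * 𝔼 q X)
    ≡⟨ cong (λ p → 𝟙 ((A ∖ v) u) * (p * 𝔼 q X)) (sumChoices-selects (q u) v) ⟩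
  𝟙 ((A ∖ v) u) * (q u (just v) * 𝔼 q X)
    ∎
  where
  X : Config n → ℚ
  X c = card (reach k (A ∖ v) c u)
  X-ignores-u : IgnoresCoordinate u X
  X-ignores-u agree = sum-cong-≗ (cong 𝟙 ∘ reach-ignores-start-choice k agree)
  split-indicator : ∀ c →
    𝟙 (firstHop A c v u) * X c ≡ 𝟙 ((A ∖ v) u) * (𝟙 (selects (c u) v) * X c)
  split-indicator c = begin-equality
    𝟙 (firstHop A c v u) * X c
      ≡⟨ cong (_* X c) (𝟙-∧ ((A ∖ v) u) (live c v u)) ⟩
    𝟙 ((A ∖ v) u) * 𝟙 (live c v u) * X c
      ≡⟨ cong (λ b → 𝟙 ((A ∖ v) u) * 𝟙 b * X c) (live≡selects c v u) ⟩
    𝟙 ((A ∖ v) u) * 𝟙 (selects (c u) v) * X c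
      ≡⟨ ℚ.*-assoc (𝟙 ((A ∖ v) u)) _ _ ⟩
    𝟙 ((A ∖ v) u) * (𝟙 (selects (c u) v) * X c) ∎

-- The linear threshold model with slackness

degWithin : ∀ {n} → Graph n → (Fin n → Bool) → Fin n → ℚ
degWithin G A v = card (λ w → A w ∧ adj G v w)

1+degWithin-∖≤card-adj : ∀ {n} (G : Graph n) A v u → T (adj G u v) →
                         1ℚ + degWithin G (A ∖ v) u ≤ card (adj G u)
1+degWithin-∖≤card-adj G A v u uv = begin
  1ℚ + degWithin G (A ∖ v) u                 ≡⟨ cong (_+ degWithin G (A ∖ v) u) (card-singleton v) ⟨
  card (singleton v) + degWithin G (A ∖ v) u ≤⟨ card-disjoint-≤ v-adj other-adj disjoint ⟩
  card (adj G u)                             ∎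
  where
  v-adj : ∀ y → T (singleton v y) → T (adj G u y)
  v-adj y v≡y = subst (T ∘ adj G u) (toWitness {a? = v ≟ y} v≡y) uv
  other-adj : ∀ y → T ((A ∖ v) y ∧ adj G u y) → T (adj G u y)
  other-adj y = proj₂ ∘ to (T-∧ {(A ∖ v) y})
  disjoint : ∀ y → T (singleton v y) → ¬ T ((A ∖ v) y ∧ adj G u y)
  disjoint y v≡y other =
    proj₂ (∖-elim A (proj₁ (to (T-∧ {(A ∖ v) y}) other))) (toWitness {a? = v ≟ y} v≡y)

module _ {n} (G : Graph n) (θ : Fin n → ℚ) (θ∈[0,1] : ∀ w → (0ℚ ≤ θ w) × (θ w ≤ 1ℚ)) where

  private
    q : Fin n → Maybe (Fin n) → ℚ
    q = probChoice G θ

    0≤1/n : ∀ d → 0ℚ ≤ (+ 1) / suc d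
    0≤1/n d = ℚ.nonNegative⁻¹ _ {{ℚ.normalize-nonNeg 1 (suc d)}}

    0≤1-θ : ∀ w → 0ℚ ≤ 1ℚ - θ w
    0≤1-θ w =
      subst (_≤ 1ℚ - θ w) (ℚ.+-inverseʳ (θ w)) (ℚ.+-monoˡ-≤ (- θ w) (proj₂ (θ∈[0,1] w)))

    0*p≤𝟙 : ∀ p b → 0ℚ * p ≤ 𝟙 b
    0*p≤𝟙 p b = subst (_≤ 𝟙 b) (sym (ℚ.*-zeroˡ p)) (𝟙-nonNeg b)

    card-adj≡deg : ∀ {w d} → deg G w ≡ d → card (adj G w) ≡ (+ d) / 1
    card-adj≡deg {w} deg≡d = trans (sym (countB≡card (adj G w))) (cong (λ d → (+ d) / 1) deg≡d)

  probChoice-nonNeg : ∀ w a → 0ℚ ≤ q w a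
  probChoice-nonNeg w a with deg G w | a
  ... | zero  | nothing = 0≤1
  ... | zero  | just _  = ℚ.≤-refl
  ... | suc d | nothing = 0≤1-θ w
  ... | suc d | just u with adj G u w
  ...   | true  = *-nonNeg (proj₁ (θ∈[0,1] w)) (0≤1/n d)
  ...   | false = ℚ.≤-refl

  probChoice-total : ∀ w → sumChoices (q w) ≡ 1ℚ
  probChoice-total w = trans (sumChoices-split (q w)) split-total
    where
    split-total : q w nothing + sum (q w ∘ just) ≡ 1ℚ
    split-total with deg G w in deg≡
    ... | zero  = trans (cong (_+_ 1ℚ) (sum-replicate-zero n)) (ℚ.+-identityʳ 1ℚ)
    ... | suc d = begin-equality
      (1ℚ - θ w) + sum (λ x → if adj G x w then p else 0ℚ)
        ≡⟨ cong (_+_ (1ℚ - θ w)) (sum-cong-≗ (λ x → if-then-0≡*𝟙 (adj G x w) p)) ⟩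
      (1ℚ - θ w) + sum (λ x → p * 𝟙 (adj G x w))
        ≡⟨ cong (_+_ (1ℚ - θ w)) (*-distribˡ-sum p (λ x → 𝟙 (adj G x w))) ⟨
      (1ℚ - θ w) + p * card (λ x → adj G x w)
        ≡⟨ cong (λ d → (1ℚ - θ w) + p * d) in-degree ⟩
      (1ℚ - θ w) + p * (+ suc d / 1)
        ≡⟨ cong (_+_ (1ℚ - θ w)) (p*1/n*n≡p (θ w) d) ⟩
      (1ℚ - θ w) + θ w
        ≡⟨ ℚ.+-assoc 1ℚ (- θ w) (θ w) ⟩
      1ℚ + (- θ w + θ w)
        ≡⟨ cong (_+_ 1ℚ) (ℚ.+-inverseˡ (θ w)) ⟩
      1ℚ ∎
      where
      p : ℚ
      p = θ w * (+ 1 / suc d)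
      in-degree : card (λ x → adj G x w) ≡ (+ suc d) / 1
      in-degree = trans (sum-cong-≗ (λ x → cong 𝟙 (symm G x w))) (card-adj≡deg deg≡)

  probChoice-just*[1+degWithin]≤𝟙 : ∀ A v u →
    q u (just v) * (1ℚ + degWithin G (A ∖ v) u) ≤ 𝟙 (adj G v u)
  probChoice-just*[1+degWithin]≤𝟙 A v u with deg G u in deg≡
  ... | zero = 0*p≤𝟙 (1ℚ + degWithin G (A ∖ v) u) (adj G v u)
  ... | suc d with adj G v u in vu
  ...   | false = 0*p≤𝟙 (1ℚ + degWithin G (A ∖ v) u) false
  ...   | true  = begin
    θ u * (+ 1 / suc d) * (1ℚ + degWithin G (A ∖ v) u)
      ≤⟨ *-monoˡ-≤ (*-nonNeg (proj₁ (θ∈[0,1] u)) (0≤1/n d)) 1+degWithin≤deg ⟩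
    θ u * (+ 1 / suc d) * (+ suc d / 1)
      ≡⟨ p*1/n*n≡p (θ u) d ⟩
    θ u
      ≤⟨ proj₂ (θ∈[0,1] u) ⟩
    1ℚ ∎
    where
    1+degWithin≤deg : 1ℚ + degWithin G (A ∖ v) u ≤ (+ suc d) / 1
    1+degWithin≤deg = begin
      1ℚ + degWithin G (A ∖ v) u
        ≤⟨ 1+degWithin-∖≤card-adj G A v u (from T-≡ (trans (symm G u v) vu)) ⟩
      card (adj G u)
        ≡⟨ card-adj≡deg deg≡ ⟩
      (+ suc d) / 1 ∎

  𝔼-card-reach≤1+degWithin : ∀ k A v → 𝔼 q (λ c → card (reach k A c v)) ≤ 1ℚ + degWithin G A v
  𝔼-card-reach≤1+degWithin zero A v = begin
    𝔼 q (λ c → card (singleton v)) ≡⟨ 𝔼-cong q (λ _ → card-singleton v) ⟩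
    𝔼 q (λ _ → 1ℚ)                 ≡⟨ 𝔼-const-1 q probChoice-total ⟩
    1ℚ                             ≤⟨ p≤p+q (sum-nonNeg (λ w → 𝟙-nonNeg (A w ∧ adj G v w))) ⟩
    1ℚ + degWithin G A v           ∎
  𝔼-card-reach≤1+degWithin (suc k) A v = begin
    𝔼 q (λ c → card (reach (suc k) A c v))
      ≤⟨ 𝔼-mono q probChoice-nonNeg (λ c → card-reach-suc≤1+∑ k A c v) ⟩
    𝔼 q (λ c → 1ℚ + sum (λ u → hop u c))
      ≡⟨ 𝔼-+ q (λ _ → 1ℚ) _ ⟩
    𝔼 q (λ _ → 1ℚ) + 𝔼 q (λ c → sum (λ u → hop u c))
      ≡⟨ cong₂ _+_ (𝔼-const-1 q probChoice-total) (𝔼-∑ q hop) ⟩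
    1ℚ + sum (λ u → 𝔼 q (hop u))
      ≤⟨ ℚ.+-monoʳ-≤ 1ℚ (sum-mono-≤ 𝔼-hop≤) ⟩
    1ℚ + degWithin G A v ∎
    where
    hop : Fin n → Config n → ℚ
    hop u c = 𝟙 (firstHop A c v u) * card (reach k (A ∖ v) c u)
    𝔼-hop≤ : ∀ u → 𝔼 q (hop u) ≤ 𝟙 (A u ∧ adj G v u)
    𝔼-hop≤ u = begin
      𝔼 q (hop u)
        ≡⟨ 𝔼-firstHop k q A v u (probChoice-total u) ⟩
      𝟙 ((A ∖ v) u) * (q u (just v) * 𝔼 q (λ c → card (reach k (A ∖ v) c u)))
        ≤⟨ *-monoˡ-≤ (𝟙-nonNeg ((A ∖ v) u))
             (*-monoˡ-≤ (probChoice-nonNeg u (just v)) (𝔼-card-reach≤1+degWithin k (A ∖ v) u)) ⟩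
      𝟙 ((A ∖ v) u) * (q u (just v) * (1ℚ + degWithin G (A ∖ v) u))
        ≤⟨ *-monoˡ-≤ (𝟙-nonNeg ((A ∖ v) u)) (probChoice-just*[1+degWithin]≤𝟙 A v u) ⟩
      𝟙 ((A ∖ v) u) * 𝟙 (adj G v u)
        ≤⟨ *-monoʳ-≤ (𝟙-nonNeg (adj G v u)) (𝟙-mono (proj₁ ∘ ∖-elim A)) ⟩
      𝟙 (A u) * 𝟙 (adj G v u)
        ≡⟨ 𝟙-∧ (A u) (adj G v u) ⟨
      𝟙 (A u ∧ adj G v u) ∎

σ-singleton≡𝔼-card-reach : ∀ {n} (G : Graph n) θ v →
  σ G θ (singleton v) ≡ 𝔼 (probChoice G θ) (λ c → card (reach n (λ _ → true) c v))
σ-singleton≡𝔼-card-reach {n} G θ v = 𝔼-cong (probChoice G θ) λ c →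
  trans (countB≡card (infected c (singleton v))) (cong card (sym (reach-everywhere≡iter n c v)))

lemma13 : (n : ℕ) (G : Graph n) (θ : Fin n → ℚ) →
            (∀ w → (0ℚ ≤ θ w) × (θ w ≤ 1ℚ)) →
            (v : Fin n) → σ G θ (singleton v) ≤ (+ suc (deg G v)) / 1
lemma13 n G θ θ∈[0,1] v = begin
  σ G θ (singleton v)
    ≡⟨ σ-singleton≡𝔼-card-reach G θ v ⟩
  𝔼 (probChoice G θ) (λ c → card (reach n everywhere c v))
    ≤⟨ 𝔼-card-reach≤1+degWithin G θ θ∈[0,1] n everywhere v ⟩
  1ℚ + degWithin G everywhere v
    ≡⟨ cong (_+_ 1ℚ) (countB≡card (adj G v)) ⟨
  1ℚ + (+ deg G v) / 1
    ≡⟨ /1-suc (deg G v) ⟨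
  (+ suc (deg G v)) / 1 ∎
  where
  everywhere : Fin n → Bool
  everywhere _ = true
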